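{- Let $Q$ be a unital quantale, $i\in Q$ with $\top\cdot i\cdot\top=i$, and $R=\{(\bot,i)\}$. Then $Q_R$ (with the quantale structure induced by $\rho_R$) is isomorphic to the quotient of $Q$ by the smallest quantale congruence whose $\bot$-class is $[\bot,i]$; in other words, that smallest congruence is precisely $\ker\rho_R=\{(a,b)\mid\rho_R(a)=\rho_R(b)\}$.
   Context: A unital quantale is a complete lattice $Q$ with an associative multiplication with unit $1$ distributing over arbitrary joins in both arguments. A quantale congruence is an equivalence relation compatible with arbitrary joins and multiplication. For $R\subseteq Q\times Q$, an element $s\in Q$ is $R$-saturated if for all $(a,b)\in R$ and all $c,d\in Q$: $cad\le s$ iff $cbd\le s$; $ac\le s$ iff $bc\le s$; $ca\le s$ iff $cb\le s$; $a\le s$ iff $b\le s$; $Q_R$ is the set of $R$-saturated elements, and $\rho_R(a)=\bigwedge\{s\in Q_R\mid a\le s\}$. The structure induced by $\rho_R$ on $Q_R$ has joins $\rho_R(\bigvee S)$ and product $\rho_R(ab)$. $[\bot,i]=\{x\in Q\mid x\le i\}$. -}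

module Defs where

open import Level using (Level; suc; Lift)
open import Data.Product using (Σ; ∃; ∃-syntax; _×_; _,_)
open import Data.Empty using (⊥)
open import Data.Unit using (⊤)
open import Relation.Binary.PropositionalEquality using (_≡_)
open import Relation.Binary.Structures using (IsPartialOrder; IsEquivalence)
open import Function.Bundles using (_⇔_)

record UnitalQuantale (ℓ : Level) : Set (suc ℓ) where
  infixl 7 _·_
  infix 4 _≤_
  field
    Carrier        : Set ℓ
    _≤_            : Carrier → Carrier → Set ℓ
    isPartialOrder : IsPartialOrder _≡_ _≤_
    ⋁              : (Carrier → Set ℓ) → Carrier
    ⋁-upper        : ∀ (S : Carrier → Set ℓ) x → S x → x ≤ ⋁ S
    ⋁-least        : ∀ (S : Carrier → Set ℓ) y → (∀ x → S x → x ≤ y) → ⋁ S ≤ y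
    _·_            : Carrier → Carrier → Carrier
    ·-assoc        : ∀ a b c → (a · b) · c ≡ a · (b · c)
    1q             : Carrier
    ·-identityˡ    : ∀ a → 1q · a ≡ a
    ·-identityʳ    : ∀ a → a · 1q ≡ a
    ·-distribˡ-⋁   : ∀ a (S : Carrier → Set ℓ) →
                     a · ⋁ S ≡ ⋁ (λ x → ∃[ s ] (S s × x ≡ a · s))
    ·-distribʳ-⋁   : ∀ (S : Carrier → Set ℓ) a →
                     ⋁ S · a ≡ ⋁ (λ x → ∃[ s ] (S s × x ≡ s · a))

module QuantaleNotions {ℓ : Level} (Q : UnitalQuantale ℓ) where
  open UnitalQuantale Q

  ⊥q : Carrier
  ⊥q = ⋁ (λ _ → Lift ℓ ⊥)

  ⊤q : Carrier
  ⊤q = ⋁ (λ _ → Lift ℓ ⊤)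

  ⋀ : (Carrier → Set ℓ) → Carrier
  ⋀ S = ⋁ (λ x → ∀ s → S s → x ≤ s)

  ⋁fam : {J : Set ℓ} → (J → Carrier) → Carrier
  ⋁fam {J} f = ⋁ (λ x → ∃[ j ] (f j ≡ x))

  Saturated : (Carrier → Carrier → Set ℓ) → Carrier → Set ℓ
  Saturated R s = ∀ a b → R a b →
      (∀ c d → (c · a · d ≤ s) ⇔ (c · b · d ≤ s))
    × (∀ c → (a · c ≤ s) ⇔ (b · c ≤ s))
    × (∀ c → (c · a ≤ s) ⇔ (c · b ≤ s))
    × ((a ≤ s) ⇔ (b ≤ s))

  ρ : (Carrier → Carrier → Set ℓ) → Carrier → Carrier
  ρ R a = ⋀ (λ s → Saturated R s × a ≤ s)

  kerρ : (Carrier → Carrier → Set ℓ) → Carrier → Carrier → Set ℓ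
  kerρ R a b = ρ R a ≡ ρ R b

  record IsQuantaleCongruence (θ : Carrier → Carrier → Set ℓ) : Set (suc ℓ) where
    field
      isEquivalence : IsEquivalence θ
      ⋁-compat      : ∀ (J : Set ℓ) (f g : J → Carrier) →
                      (∀ j → θ (f j) (g j)) → θ (⋁fam f) (⋁fam g)
      ·-compat      : ∀ a b c d → θ a b → θ c d → θ (a · c) (b · d)

  ⊥ClassIs↓ : (Carrier → Carrier → Set ℓ) → Carrier → Set ℓ
  ⊥ClassIs↓ θ i = ∀ x → θ x ⊥q ⇔ (x ≤ i)

  singletonRel : Carrier → Carrier → Carrier → Set ℓ
  singletonRel i a b = (a ≡ ⊥q) × (b ≡ i)

module Submission where

-- Write R = {(⊥, i)} with i two-sided (⊤ · i · ⊤ = i).  Then an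
-- element s is R-saturated exactly when i ≤ s: the four saturation conditions
-- compare a product containing ⊥ (which is ⊥) with one containing i (which is
-- ≤ i by two-sidedness).  Hence ρ_R(a) is simply the binary join a ∨ i.

open import Defs
open import Data.Bool using (Bool; true; false)
open import Data.Product using (_×_; _,_; proj₁; proj₂)
open import Data.Unit using (tt)
open import Function.Bundles using (mk⇔; Equivalence)
open import Level using (Level; Lift; lift)
open import Relation.Binary.PropositionalEquality as ≡
  using (_≡_; refl; sym; subst; subst₂)
open import Relation.Binary.Structures using (IsPartialOrder; IsEquivalence)

module QuantaleTheory {ℓ : Level} (Q : UnitalQuantale ℓ) where
  open UnitalQuantale Q
  open QuantaleNotions Q
  open IsPartialOrder isPartialOrder public
    using (reflexive; trans; antisym) renaming (refl to ≤-refl)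

  ⊥-least : ∀ x → ⊥q ≤ x
  ⊥-least x = ⋁-least _ x (λ _ ())

  ⊤-greatest : ∀ x → x ≤ ⊤q
  ⊤-greatest x = ⋁-upper _ x (lift tt)

  ⋁fam-upper : ∀ {J : Set ℓ} (f : J → Carrier) j → f j ≤ ⋁fam f
  ⋁fam-upper f j = ⋁-upper _ (f j) (j , refl)

  ⋁fam-least : ∀ {J : Set ℓ} (f : J → Carrier) t → (∀ j → f j ≤ t) → ⋁fam f ≤ t
  ⋁fam-least f t h = ⋁-least _ t (λ { x (j , refl) → h j })

  ⋁·-least : ∀ S z t → (∀ s → S s → s · z ≤ t) → ⋁ S · z ≤ t
  ⋁·-least S z t h = subst (_≤ t) (sym (·-distribʳ-⋁ S z))
    (⋁-least _ t (λ { x (s , Ss , refl) → h s Ss }))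

  ·⋁-least : ∀ S z t → (∀ s → S s → z · s ≤ t) → z · ⋁ S ≤ t
  ·⋁-least S z t h = subst (_≤ t) (sym (·-distribˡ-⋁ z S))
    (⋁-least _ t (λ { x (s , Ss , refl) → h s Ss }))

  -- Multiplication is monotone in each argument: y is the join of its
  -- down-set, and x · z is one of the products making up (⋁ ↓y) · z.

  ⋁-downset : ∀ y → ⋁ (λ w → w ≤ y) ≡ y
  ⋁-downset y = antisym (⋁-least _ y (λ _ w≤y → w≤y)) (⋁-upper _ y ≤-refl)

  ·-monoˡ : ∀ {x y} z → x ≤ y → x · z ≤ y · z
  ·-monoˡ {x} {y} z x≤y = subst (λ w → x · z ≤ w · z) (⋁-downset y)
    (subst (x · z ≤_) (sym (·-distribʳ-⋁ _ z)) (⋁-upper _ (x · z) (x , x≤y , refl)))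

  ·-monoʳ : ∀ {x y} z → x ≤ y → z · x ≤ z · y
  ·-monoʳ {x} {y} z x≤y = subst (λ w → z · x ≤ z · w) (⋁-downset y)
    (subst (z · x ≤_) (sym (·-distribˡ-⋁ z _)) (⋁-upper _ (z · x) (x , x≤y , refl)))

  ·-mono : ∀ {a b c d} → a ≤ b → c ≤ d → a · c ≤ b · d
  ·-mono {b = b} {c = c} a≤b c≤d = trans (·-monoˡ c a≤b) (·-monoʳ b c≤d)

  -- ⊥ is the empty join, hence annihilates products on either side.

  ⊥·-least : ∀ c t → ⊥q · c ≤ t
  ⊥·-least c t = ⋁·-least _ c t (λ _ ())

  ·⊥-least : ∀ c t → c · ⊥q ≤ t
  ·⊥-least c t = ·⋁-least _ c t (λ _ ())

  ·⊥·-least : ∀ c d t → c · ⊥q · d ≤ t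
  ·⊥·-least c d t = trans (·-monoˡ d (·⊥-least c ⊥q)) (⊥·-least d t)

  pair : Carrier → Carrier → Lift ℓ Bool → Carrier
  pair a b (lift true)  = a
  pair a b (lift false) = b

  infixr 6 _∨_
  _∨_ : Carrier → Carrier → Carrier
  a ∨ b = ⋁fam (pair a b)

  ∨-upperˡ : ∀ a b → a ≤ a ∨ b
  ∨-upperˡ a b = ⋁fam-upper (pair a b) (lift true)

  ∨-upperʳ : ∀ a b → b ≤ a ∨ b
  ∨-upperʳ a b = ⋁fam-upper (pair a b) (lift false)

  ∨-least : ∀ {a b t} → a ≤ t → b ≤ t → a ∨ b ≤ t
  ∨-least {a} {b} {t} a≤t b≤t =
    ⋁fam-least (pair a b) t (λ { (lift true) → a≤t ; (lift false) → b≤t })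

  ∨-identityʳ : ∀ a → a ∨ ⊥q ≡ a
  ∨-identityʳ a = antisym (∨-least ≤-refl (⊥-least a)) (∨-upperˡ a ⊥q)

  ∨·∨-least : ∀ {a b c d t} → a · c ≤ t → a · d ≤ t → b · c ≤ t → b · d ≤ t →
              (a ∨ b) · (c ∨ d) ≤ t
  ∨·∨-least {a} {b} {c} {d} {t} ac ad bc bd =
    ⋁·-least _ (c ∨ d) t λ { _ (lift true , refl) → ·∨-least a ac ad
                           ; _ (lift false , refl) → ·∨-least b bc bd }
    where
      ·∨-least : ∀ x → x · c ≤ t → x · d ≤ t → x · (c ∨ d) ≤ t
      ·∨-least x xc xd = ·⋁-least _ x t λ { _ (lift true , refl) → xc
                                           ; _ (lift false , refl) → xd }

  ∨-compat : ∀ {θ} → IsQuantaleCongruence θ →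
             ∀ {a b c d} → θ a b → θ c d → θ (a ∨ c) (b ∨ d)
  ∨-compat C {a} {b} {c} {d} θab θcd =
    IsQuantaleCongruence.⋁-compat C _ (pair a c) (pair b d)
      λ { (lift true) → θab ; (lift false) → θcd }

  module TwoSided {i : Carrier} (two-sided : ⊤q · i · ⊤q ≡ i) where

    absorb : ∀ c d → c · i · d ≤ i
    absorb c d = trans (·-mono (·-monoˡ i (⊤-greatest c)) (⊤-greatest d)) (reflexive two-sided)

    absorbˡ : ∀ c → c · i ≤ i
    absorbˡ c = subst (_≤ i) (·-identityʳ (c · i)) (absorb c 1q)

    absorbʳ : ∀ c → i · c ≤ i
    absorbʳ c = subst (λ w → w · c ≤ i) (·-identityˡ i) (absorb 1q c)

  record JoinWith (i : Carrier) (σ : Carrier → Carrier) : Set ℓ where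
    field
      upperˡ : ∀ a → a ≤ σ a
      upperʳ : ∀ a → i ≤ σ a
      least  : ∀ {a t} → a ≤ t → i ≤ t → σ a ≤ t

  module JoinWithTheory {i : Carrier} {σ : Carrier → Carrier} (J : JoinWith i σ) where
    open JoinWith J

    σ-is-∨ : ∀ a → σ a ≡ a ∨ i
    σ-is-∨ a = antisym (least (∨-upperˡ a i) (∨-upperʳ a i)) (∨-least (upperˡ a) (upperʳ a))

    σ-mono : ∀ {a b} → a ≤ b → σ a ≤ σ b
    σ-mono {a} {b} a≤b = least (trans a≤b (upperˡ b)) (upperʳ b)

    σ-≡ : ∀ {a b} → a ≤ σ b → b ≤ σ a → σ a ≡ σ b
    σ-≡ {a} {b} a≤σb b≤σa = antisym (least a≤σb (upperʳ b)) (least b≤σa (upperʳ a))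

    below-σ : ∀ {a b} → σ a ≡ σ b → a ≤ σ b
    below-σ {a} σa≡σb = subst (a ≤_) σa≡σb (upperˡ a)

    σ-⊥ : σ ⊥q ≡ i
    σ-⊥ = antisym (least (⊥-least i) ≤-refl) (upperʳ ⊥q)

    kerσ : Carrier → Carrier → Set ℓ
    kerσ a b = σ a ≡ σ b

    kerσ-⊥Class : ⊥ClassIs↓ kerσ i
    kerσ-⊥Class x = mk⇔ (λ σx≡σ⊥ → subst (x ≤_) σ-⊥ (below-σ σx≡σ⊥))
                        (λ x≤i → σ-≡ (subst (x ≤_) (sym σ-⊥) x≤i) (⊥-least (σ x)))

    -- ker σ is contained in every congruence identifying i with ⊥:
    -- a = a ∨ ⊥ is then congruent to a ∨ i = σ a.
    kerσ-minimal : ∀ θ → IsQuantaleCongruence θ → θ i ⊥q → ∀ a b → kerσ a b → θ a b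
    kerσ-minimal θ C θi⊥ a b σa≡σb =
      E.trans (θ-σ a) (subst (λ w → θ w b) (sym σa≡σb) (E.sym (θ-σ b)))
      where
        module E = IsEquivalence (IsQuantaleCongruence.isEquivalence C)
        θ-σ : ∀ x → θ x (σ x)
        θ-σ x = subst₂ θ (∨-identityʳ x) (sym (σ-is-∨ x)) (∨-compat C E.refl (E.sym θi⊥))

    module _ (two-sided : ⊤q · i · ⊤q ≡ i) where
      open TwoSided two-sided

      -- (b ∨ i)(d ∨ i) is the join of bd, bi, id, ii, all but the first below i.
      σ·σ≤σ· : ∀ b d → σ b · σ d ≤ σ (b · d)
      σ·σ≤σ· b d = subst₂ (λ x y → x · y ≤ σ (b · d)) (sym (σ-is-∨ b)) (sym (σ-is-∨ d))
        (∨·∨-least (upperˡ (b · d)) (via-i (absorbˡ b)) (via-i (absorbʳ d)) (via-i (absorbʳ i)))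
        where
          via-i : ∀ {x} → x ≤ i → x ≤ σ (b · d)
          via-i x≤i = trans x≤i (upperʳ (b · d))

      ·-below-σ : ∀ {a b c d} → a ≤ σ b → c ≤ σ d → a · c ≤ σ (b · d)
      ·-below-σ {b = b} {d = d} a≤σb c≤σd = trans (·-mono a≤σb c≤σd) (σ·σ≤σ· b d)

      ⋁-below-σ : ∀ {J : Set ℓ} (f g : J → Carrier) → (∀ j → kerσ (f j) (g j)) →
                  ⋁fam f ≤ σ (⋁fam g)
      ⋁-below-σ f g f~g = ⋁fam-least f _ λ j →
        trans (below-σ (f~g j)) (σ-mono (⋁fam-upper g j))

      kerσ-congruence : IsQuantaleCongruence kerσ
      kerσ-congruence = record
        { isEquivalence = record { refl = refl ; sym = sym ; trans = ≡.trans }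
        ; ⋁-compat = λ _ f g f~g →
            σ-≡ (⋁-below-σ f g f~g) (⋁-below-σ g f (λ j → sym (f~g j)))
        ; ·-compat = λ _ _ _ _ a~b c~d →
            σ-≡ (·-below-σ (below-σ a~b) (below-σ c~d))
                (·-below-σ (below-σ (sym a~b)) (below-σ (sym c~d)))
        }

  module SingletonRelation {i : Carrier} (two-sided : ⊤q · i · ⊤q ≡ i) where
    open TwoSided two-sided

    saturated⇒above : ∀ s → Saturated (singletonRel i) s → i ≤ s
    saturated⇒above s sat =
      Equivalence.to (proj₂ (proj₂ (proj₂ (sat ⊥q i (refl , refl))))) (⊥-least s)

    above⇒saturated : ∀ s → i ≤ s → Saturated (singletonRel i) s
    above⇒saturated s i≤s .⊥q .i (refl , refl) =
        (λ c d → mk⇔ (λ _ → trans (absorb c d) i≤s) (λ _ → ·⊥·-least c d s))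
      , (λ c → mk⇔ (λ _ → trans (absorbʳ c) i≤s) (λ _ → ⊥·-least c s))
      , (λ c → mk⇔ (λ _ → trans (absorbˡ c) i≤s) (λ _ → ·⊥-least c s))
      , mk⇔ (λ _ → i≤s) (λ _ → ⊥-least s)

    ρ-joinWith : JoinWith i (ρ (singletonRel i))
    ρ-joinWith = record
      { upperˡ = λ a → ⋁-upper _ a (λ _ sat×a≤s → proj₂ sat×a≤s)
      ; upperʳ = λ a → ⋁-upper _ i (λ s sat×a≤s → saturated⇒above s (proj₁ sat×a≤s))
      ; least  = λ {t = t} a≤t i≤t → ⋁-least _ t (λ _ below → below t (above⇒saturated t i≤t , a≤t))
      }

corollary4p13 : ∀ {ℓ : Level} (Q : UnitalQuantale ℓ) (i : UnitalQuantale.Carrier Q) →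
    let open UnitalQuantale Q
        open QuantaleNotions Q
        κ = kerρ (singletonRel i)
    in (⊤q · i) · ⊤q ≡ i →
         IsQuantaleCongruence κ
       × ⊥ClassIs↓ κ i
       × (∀ θ → IsQuantaleCongruence θ → ⊥ClassIs↓ θ i → ∀ a b → κ a b → θ a b)
corollary4p13 Q i two-sided =
    kerσ-congruence two-sided
  , kerσ-⊥Class
  , λ θ C ⊥-class → kerσ-minimal θ C (Equivalence.from (⊥-class i) ≤-refl)
  where
    open QuantaleTheory Q
    open JoinWithTheory (SingletonRelation.ρ-joinWith two-sided)
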